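{- Let $\Sigma$ be an alphabet with at least two symbols. There exists an adversary for the $3 \times 3$ grid over $\Sigma$: a strategy that answers, adaptively, each query of a previously unqueried cell with a symbol of $\Sigma$, such that for every order in which the cells are queried, after each query that leaves at least one cell unread, the answers given so far can be extended to a coloring $c : [3]\times[3] \to \Sigma$ whose grid graph $G_c$ contains a cycle and also to a coloring whose grid graph is acyclic.
   Context: For a coloring $c : [m] \times [n] \to \Sigma$, the grid graph $G_c$ has vertex set $[m] \times [n]$ and an edge between $(i,j)$ and $(i',j')$ iff $|i-i'|+|j-j'|=1$ and $c(i,j)=c(i',j')$. The query order may be chosen adaptively by the querier depending on previous answers. -}

module Defs where

open import Data.Nat using (ℕ; _+_; _≤_; ∣_-_∣)
open import Data.Fin using (Fin; toℕ)
open import Data.Product using (_×_; _,_; Σ-syntax; ∃-syntax; proj₁; proj₂)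
open import Data.List using (List; []; _∷_; _++_; [_]; length)
open import Data.List.Relation.Unary.All using (All)
open import Data.List.Relation.Unary.Unique.Propositional using (Unique)
open import Data.List.Relation.Unary.Linked using (Linked)
open import Relation.Binary.PropositionalEquality using (_≡_)
open import Relation.Nullary using (¬_)
open import Data.Empty using (⊥)

Cell : Set
Cell = Fin 3 × Fin 3

Coloring : Set → Set
Coloring S = Cell → S

GridNeighbour : Cell → Cell → Set
GridNeighbour (i , j) (i' , j') = ∣ toℕ i - toℕ i' ∣ + ∣ toℕ j - toℕ j' ∣ ≡ 1

Edge : {S : Set} → Coloring S → Cell → Cell → Set
Edge c u v = GridNeighbour u v × c u ≡ c v

IsCycle : {S : Set} → Coloring S → List Cell → Set
IsCycle c [] = ⊥
IsCycle c (v ∷ ws) =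
  3 ≤ length (v ∷ ws) × Unique (v ∷ ws) × Linked (Edge c) (v ∷ ws ++ [ v ])

HasCycle : {S : Set} → Coloring S → Set
HasCycle c = ∃[ vs ] IsCycle c vs

Acyclic : {S : Set} → Coloring S → Set
Acyclic c = ¬ HasCycle c

-- An adversary: given the history of (queried cell, answer) pairs so far and
-- a newly queried cell, it returns a symbol. (Fully adaptive.)
Adversary : Set → Set
Adversary S = List (Cell × S) → Cell → S

run : {S : Set} → Adversary S → List (Cell × S) → List Cell → List (Cell × S)
run A h [] = h
run A h (q ∷ qs) = run A (h ++ [ (q , A h q) ]) qs

Extends : {S : Set} → Coloring S → List (Cell × S) → Set
Extends c h = All (λ p → c (proj₁ p) ≡ proj₂ p) h

-- The strategy answers by the default coloring "only the centre is marked", with one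
-- trap: if the first seven queries avoid the centre, the eighth cell is marked as well.
-- While the answers follow the default and some cell y other than the centre is unread,
-- the default (whose outer ring of eight cells is a cycle) and the default with y marked
-- too (which cuts the ring into a path) are a cyclic and an acyclic extension. In the
-- trap only the centre is unread and the last cell q is marked: marking the centre as
-- well is acyclic, while leaving it unmarked closes a 4-cycle on the 2 × 2 square
-- through the centre that avoids q. Colorings are built over Bool (true = marked) and
-- transported to the alphabet along an injective map, which preserves cycles and
-- acyclicity. Acyclicity of the finitely many colorings involved is checked by
-- computation: a vertex with at most one neighbour left can be peeled off, since every
-- vertex of a cycle has two distinct neighbours on it.
module Submission where

open import Defs
open import Data.Bool using (Bool; true; false; _∨_)
open import Data.Bool.Properties using (∨-identityʳ; ∨-zeroʳ) renaming (_≟_ to _≟ᵇ_)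
open import Data.Nat using (ℕ; zero; suc; _+_; _≤_; _≤?_; z≤n; s≤s) renaming (_≟_ to _≟ⁿ_)
open import Data.Nat.Properties using (∣-∣-comm; ≤-reflexive; ≤-trans; ≤-antisym; ≰⇒>; 1+n≰n; n≤1+n; <⇒≢; suc-injective; module ≤-Reasoning)
open import Data.Fin using (Fin; zero; suc; toℕ)
open import Data.Fin.Properties using () renaming (_≟_ to _≟ᶠ_)
open import Data.Product using (_×_; ∃-syntax; _,_; proj₁; map₁; map₂)
open import Data.Product.Properties using (≡-dec)
open import Data.Sum using (_⊎_; inj₁; inj₂; [_,_]′)
open import Data.Maybe using (just; nothing)
open import Data.Empty using (⊥-elim)
open import Data.List using (List; []; _∷_; _++_; [_]; _∷ʳ_; length; map; filter; find; allFin; cartesianProduct; initLast; _∷ʳ′_)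
open import Data.List.Properties using (++-assoc; ++-identityʳ; length-++-comm; length-removeAt′; map-++; map-∘; map-id)
open import Data.List.Reverse using (Reverse; []; _∶_∶ʳ_; reverseView)
open import Data.List.Relation.Unary.All as All using (All; []; _∷_; all?)
open import Data.List.Relation.Unary.All.Properties using (¬All⇒Any¬) renaming (map⁺ to All-map⁺; ++⁺ to All-++⁺)
open import Data.List.Relation.Unary.Any using (here; there; index; _─_; satisfied)
open import Data.List.Relation.Unary.Linked as Linked using (Linked; [-]; _∷_; linked?)
open import Data.List.Relation.Unary.Unique.Propositional using (Unique; []; _∷_)
open import Data.List.Relation.Unary.Unique.Propositional.Properties using (cartesianProduct⁺; allFin⁺) renaming (++⁺ to Unique-++⁺)
open import Data.List.Relation.Unary.Unique.DecPropositional using (unique?)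
open import Data.List.Relation.Binary.Subset.Propositional using (_⊆_)
open import Data.List.Relation.Binary.Permutation.Propositional using (↭-sym)
open import Data.List.Relation.Binary.Permutation.Propositional.Properties using (Any-resp-↭; ∷↭∷ʳ)
open import Data.List.Membership.Propositional using (_∈_; _∉_)
open import Data.List.Membership.Propositional.Properties using (∈-allFin; ∈-cartesianProduct⁺; ∈-filter⁺; ∈-++⁻; ∈-++⁺ˡ; ∈-++⁺ʳ)
open import Data.List.Membership.DecPropositional using () renaming (_∈?_ to member?)
open import Function using (_∘_)
open import Function.Definitions using (Injective)
open import Relation.Nullary using (¬_; ¬?; Dec; yes; no; does; _×-dec_; _⊎-dec_; contradiction)
open import Relation.Nullary.Decidable using (True; toWitness; dec-true; dec-false)
open import Relation.Unary using (Decidable)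
open import Relation.Binary.Definitions using (DecidableEquality)
open import Relation.Binary.PropositionalEquality using (_≡_; _≢_; ≢-sym; refl; sym; trans; cong; cong₂; subst; module ≡-Reasoning)

module _ {A : Set} where

  ∈-─ : ∀ {x y : A} {ys} (x∈ys : x ∈ ys) → y ∈ ys → y ≢ x → y ∈ (ys ─ x∈ys)
  ∈-─ (here refl) (here refl) y≢x = ⊥-elim (y≢x refl)
  ∈-─ (here refl) (there y∈ys) _ = y∈ys
  ∈-─ (there x∈ys) (here refl) _ = here refl
  ∈-─ (there x∈ys) (there y∈ys) y≢x = there (∈-─ x∈ys y∈ys y≢x)

  unique-⊆⇒length-≤ : ∀ {xs ys : List A} → Unique xs → xs ⊆ ys → length xs ≤ length ys
  unique-⊆⇒length-≤ {[]} _ _ = z≤n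
  unique-⊆⇒length-≤ {x ∷ xs} {ys} (x∉xs ∷ unique) xs⊆ys = begin
    suc (length xs)           ≤⟨ s≤s (unique-⊆⇒length-≤ unique xs⊆ys─x) ⟩
    suc (length (ys ─ x∈ys))  ≡⟨ sym (length-removeAt′ ys (index x∈ys)) ⟩
    length ys                 ∎
    where
    open ≤-Reasoning
    x∈ys : x ∈ ys
    x∈ys = xs⊆ys (here refl)
    xs⊆ys─x : xs ⊆ (ys ─ x∈ys)
    xs⊆ys─x y∈xs = ∈-─ x∈ys (xs⊆ys (there y∈xs)) (λ y≡x → All.lookup x∉xs y∈xs (sym y≡x))

  ∈-∉⇒≢ : ∀ {x y : A} {xs} → x ∈ xs → y ∉ xs → x ≢ y
  ∈-∉⇒≢ x∈xs y∉xs refl = y∉xs x∈xs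

  ∈-≢⇒2≤length : ∀ {xs : List A} {a b} → a ∈ xs → b ∈ xs → a ≢ b → 2 ≤ length xs
  ∈-≢⇒2≤length {_ ∷ []} (here refl) (here refl) a≢b = ⊥-elim (a≢b refl)
  ∈-≢⇒2≤length {_ ∷ _ ∷ _} _ _ _ = s≤s (s≤s z≤n)

  length-∷ʳ : ∀ (xs : List A) {x} → length (xs ∷ʳ x) ≡ suc (length xs)
  length-∷ʳ xs {x} = length-++-comm xs [ x ]

  unique-∷ʳ⇒∉ : ∀ (xs : List A) {x} → Unique (xs ∷ʳ x) → x ∉ xs
  unique-∷ʳ⇒∉ (y ∷ ys) (y∉ ∷ _) (here x≡y) = All.lookup y∉ (∈-++⁺ʳ ys (here refl)) (sym x≡y)
  unique-∷ʳ⇒∉ (y ∷ ys) (_ ∷ unique) (there x∈ys) = unique-∷ʳ⇒∉ ys unique x∈ys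

  unique-∷ʳ : ∀ {x} {xs : List A} → Unique (x ∷ xs) → Unique (xs ∷ʳ x)
  unique-∷ʳ (x∉xs ∷ unique) = Unique-++⁺ unique ([] ∷ []) λ { (x∈xs , here refl) → All.lookup x∉xs x∈xs refl }

module _ {A : Set} {R : A → A → Set} where

  Linked-∷ʳ : ∀ {xs y z} → Linked R (xs ∷ʳ y) → R y z → Linked R (xs ∷ʳ y ∷ʳ z)
  Linked-∷ʳ {[]} [-] r = r ∷ [-]
  Linked-∷ʳ {_ ∷ []} (r′ ∷ walk) r = r′ ∷ Linked-∷ʳ {[]} walk r
  Linked-∷ʳ {_ ∷ x ∷ xs} (r′ ∷ walk) r = r′ ∷ Linked-∷ʳ {x ∷ xs} walk r

  Linked-into-last : ∀ {x xs y} → Linked R (x ∷ xs ∷ʳ y) → ∃[ p ] (p ∈ x ∷ xs × R p y)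
  Linked-into-last {xs = []} (r ∷ [-]) = _ , here refl , r
  Linked-into-last {xs = _ ∷ _} (_ ∷ walk) = map₂ (map₁ there) (Linked-into-last walk)

_≟ᶜ_ : DecidableEquality Cell
_≟ᶜ_ = ≡-dec _≟ᶠ_ _≟ᶠ_

_∈ᶜ?_ : (x : Cell) (xs : List Cell) → Dec (x ∈ xs)
_∈ᶜ?_ = member? _≟ᶜ_

allCells : List Cell
allCells = cartesianProduct (allFin 3) (allFin 3)

∈-allCells : ∀ x → x ∈ allCells
∈-allCells (i , j) = ∈-cartesianProduct⁺ (∈-allFin i) (∈-allFin j)

allCells-unique : Unique allCells
allCells-unique = cartesianProduct⁺ (allFin⁺ 3) (allFin⁺ 3)

missing-cell : ∀ xs → length xs ≤ 8 → ∃[ y ] y ∉ xs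
missing-cell xs ≤8 with all? (_∈ᶜ? xs) allCells
... | yes covered = ⊥-elim (1+n≰n (≤-trans (unique-⊆⇒length-≤ allCells-unique (All.lookup covered)) ≤8))
... | no uncovered = satisfied (¬All⇒Any¬ (_∈ᶜ? xs) allCells uncovered)

∀-cell : {P : Cell → Set} (P? : Decidable P) → True (all? P? allCells) → ∀ x → P x
∀-cell P? holds x = All.lookup (toWitness holds) (∈-allCells x)

module _ {S : Set} {c : Coloring S} where

  Edge-sym : ∀ {u v} → Edge c u v → Edge c v u
  Edge-sym {i , j} {i′ , j′} (adjacent , same) =
    trans (cong₂ _+_ (∣-∣-comm (toℕ i′) (toℕ i)) (∣-∣-comm (toℕ j′) (toℕ j))) adjacent , sym same

  TwoNeighboursIn : List Cell → Cell → Set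
  TwoNeighboursIn L x = ∃[ a ] ∃[ b ] (a ∈ L × b ∈ L × a ≢ b × Edge c x a × Edge c x b)

  TwoNeighboursIn-⊆ : ∀ {L L′ x} → L ⊆ L′ → TwoNeighboursIn L x → TwoNeighboursIn L′ x
  TwoNeighboursIn-⊆ L⊆L′ (a , b , a∈L , b∈L , a≢b , x~a , x~b) = a , b , L⊆L′ a∈L , L⊆L′ b∈L , a≢b , x~a , x~b

  rotate-cycle : ∀ {v ws} → IsCycle c (v ∷ ws) → IsCycle c (ws ∷ʳ v)
  rotate-cycle {ws = []} (s≤s () , _)
  rotate-cycle {v} {w ∷ ws} (long , unique , walk) =
    subst (3 ≤_) (sym (length-∷ʳ (w ∷ ws))) long ,
    unique-∷ʳ unique ,
    Linked-∷ʳ {xs = w ∷ ws} (Linked.tail walk) (Linked.head walk)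

  head-has-two-neighbours : ∀ {v ws} → IsCycle c (v ∷ ws) → TwoNeighboursIn (v ∷ ws) v
  head-has-two-neighbours {ws = []} (s≤s () , _)
  head-has-two-neighbours {ws = _ ∷ []} (s≤s (s≤s ()) , _)
  head-has-two-neighbours {ws = w ∷ u ∷ us} (_ , _ ∷ (w∉ ∷ _) , v~w ∷ walk)
    with Linked-into-last (Linked.tail walk)
  ... | p , p∈ , p~v = w , p , there (here refl) , there (there p∈) , All.lookup w∉ p∈ , v~w , Edge-sym p~v

  rotation-has-two-neighbours : ∀ xs ys → IsCycle c (xs ++ ys) → ∀ {x} → x ∈ xs → TwoNeighboursIn (xs ++ ys) x
  rotation-has-two-neighbours (v ∷ xs) ys cycle (here refl) = head-has-two-neighbours cycle
  rotation-has-two-neighbours (v ∷ xs) ys cycle (there x∈xs) =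
    TwoNeighboursIn-⊆ back (rotation-has-two-neighbours xs (ys ∷ʳ v) rotated x∈xs)
    where
    rotated : IsCycle c (xs ++ (ys ∷ʳ v))
    rotated = subst (IsCycle c) (++-assoc xs ys [ v ]) (rotate-cycle cycle)
    back : xs ++ (ys ∷ʳ v) ⊆ v ∷ (xs ++ ys)
    back = Any-resp-↭ (↭-sym (∷↭∷ʳ v (xs ++ ys))) ∘ subst (_ ∈_) (sym (++-assoc xs ys [ v ]))

  cycle-vertex-has-two-neighbours : ∀ {L x} → IsCycle c L → x ∈ L → TwoNeighboursIn L x
  cycle-vertex-has-two-neighbours {L} cycle x∈L =
    subst (λ L′ → TwoNeighboursIn L′ _) (++-identityʳ L)
      (rotation-has-two-neighbours L [] (subst (IsCycle c) (sym (++-identityʳ L)) cycle) x∈L)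

module _ {S T : Set} (f : S → T) {c : Coloring S} where

  HasCycle-∘ : HasCycle c → HasCycle (f ∘ c)
  HasCycle-∘ (v ∷ ws , long , unique , walk) = v ∷ ws , long , unique , Linked.map (map₂ (cong f)) walk

  Acyclic-∘ : Injective _≡_ _≡_ f → Acyclic c → Acyclic (f ∘ c)
  Acyclic-∘ f-injective acyclic ([] , ())
  Acyclic-∘ f-injective acyclic (v ∷ ws , long , unique , walk) =
    acyclic (v ∷ ws , long , unique , Linked.map (map₂ f-injective) walk)

module Decisions {S : Set} (_≟ˢ_ : DecidableEquality S) (c : Coloring S) where

  edge? : ∀ u v → Dec (Edge c u v)
  edge? u v = (_ ≟ⁿ 1) ×-dec (c u ≟ˢ c v)

  isCycle? : Decidable (IsCycle c)
  isCycle? [] = no λ ()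
  isCycle? (v ∷ ws) =
    (3 ≤? length (v ∷ ws)) ×-dec unique? _≟ᶜ_ (v ∷ ws)
      ×-dec linked? edge? (v ∷ ws ++ [ v ])

  liveNeighbour? : ∀ removed x u → Dec (Edge c x u × u ∉ removed)
  liveNeighbour? removed x u = edge? x u ×-dec ¬? (u ∈ᶜ? removed)

  liveNeighbours : List Cell → Cell → List Cell
  liveNeighbours removed x = filter (liveNeighbour? removed x) allCells

  Peels : List Cell → List Cell → Set
  Peels removed [] = All (_∈ removed) allCells
  Peels removed (x ∷ xs) = length (liveNeighbours removed x) ≤ 1 × Peels (x ∷ removed) xs

  peels? : ∀ removed xs → Dec (Peels removed xs)
  peels? removed [] = all? (_∈ᶜ? removed) allCells
  peels? removed (x ∷ xs) = (length (liveNeighbours removed x) ≤? 1) ×-dec peels? (x ∷ removed) xs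

  leaf-off-cycle : ∀ {L removed x} → IsCycle c L → All (_∉ L) removed →
                   length (liveNeighbours removed x) ≤ 1 → x ∉ L
  leaf-off-cycle {L} {removed} {x} cycle avoid leaf x∈L with cycle-vertex-has-two-neighbours cycle x∈L
  ... | a , b , a∈L , b∈L , a≢b , x~a , x~b =
    1+n≰n (≤-trans (∈-≢⇒2≤length (live a∈L x~a) (live b∈L x~b) a≢b) leaf)
    where
    live : ∀ {u} → u ∈ L → Edge c x u → u ∈ liveNeighbours removed x
    live {u} u∈L x~u =
      ∈-filter⁺ (liveNeighbour? removed x) (∈-allCells u) (x~u , λ u∈removed → All.lookup avoid u∈removed u∈L)

  peeling-breaks-cycle : ∀ {L} removed xs → IsCycle c L → All (_∉ L) removed → ¬ Peels removed xs
  peeling-breaks-cycle {v ∷ _} removed [] _ avoid covered = All.lookup avoid (All.lookup covered (∈-allCells v)) (here refl)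
  peeling-breaks-cycle removed (x ∷ xs) cycle avoid (leaf , rest) =
    peeling-breaks-cycle (x ∷ removed) xs cycle (leaf-off-cycle cycle avoid leaf ∷ avoid) rest

  greedyPeeling : ℕ → List Cell → List Cell
  greedyPeeling zero removed = []
  greedyPeeling (suc n) removed
    with find (λ x → ¬? (x ∈ᶜ? removed) ×-dec (length (liveNeighbours removed x) ≤? 1)) allCells
  ... | nothing = []
  ... | just x = x ∷ greedyPeeling n (x ∷ removed)

  Peelable : Set
  Peelable = Peels [] (greedyPeeling 9 [])

  peelable? : Dec Peelable
  peelable? = peels? [] (greedyPeeling 9 [])

  Peelable⇒Acyclic : Peelable → Acyclic c
  Peelable⇒Acyclic peels (_ , cycle) = peeling-breaks-cycle [] _ cycle [] peels

centre : Cell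
centre = suc zero , suc zero

onlyAt : Cell → Coloring Bool
onlyAt y x = does (x ≟ᶜ y)

centreAnd : Cell → Coloring Bool
centreAnd y x = onlyAt centre x ∨ onlyAt y x

onlyAt-self : ∀ y → onlyAt y y ≡ true
onlyAt-self y = dec-true (y ≟ᶜ y) refl

onlyAt-≢ : ∀ {x y} → x ≢ y → onlyAt y x ≡ false
onlyAt-≢ {x} {y} = dec-false (x ≟ᶜ y)

centreAnd-self : ∀ y → centreAnd y y ≡ true
centreAnd-self y = trans (cong (onlyAt centre y ∨_) (onlyAt-self y)) (∨-zeroʳ _)

centreAnd-≢ : ∀ {x y} → x ≢ y → centreAnd y x ≡ onlyAt centre x
centreAnd-≢ {x} x≢y = trans (cong (onlyAt centre x ∨_) (onlyAt-≢ x≢y)) (∨-identityʳ _)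

ring : List Cell
ring = (zero , zero) ∷ (zero , suc zero) ∷ (zero , suc (suc zero)) ∷ (suc zero , suc (suc zero)) ∷
       (suc (suc zero) , suc (suc zero)) ∷ (suc (suc zero) , suc zero) ∷ (suc (suc zero) , zero) ∷ (suc zero , zero) ∷ []

topLeftSquare bottomRightSquare : List Cell
topLeftSquare = (zero , zero) ∷ (zero , suc zero) ∷ centre ∷ (suc zero , zero) ∷ []
bottomRightSquare = centre ∷ (suc zero , suc (suc zero)) ∷ (suc (suc zero) , suc (suc zero)) ∷ (suc (suc zero) , suc zero) ∷ []

onlyAt-centre-cyclic : HasCycle (onlyAt centre)
onlyAt-centre-cyclic = ring , toWitness {a? = Decisions.isCycle? _≟ᵇ_ (onlyAt centre) ring} _

onlyAt-cyclic : ∀ y → y ≢ centre → HasCycle (onlyAt y)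
onlyAt-cyclic y y≢centre =
  [ ⊥-elim ∘ y≢centre , [ (topLeftSquare ,_) , (bottomRightSquare ,_) ]′ ]′ (∀-cell decide _ y)
  where
  decide : ∀ y → Dec (y ≡ centre ⊎ IsCycle (onlyAt y) topLeftSquare ⊎ IsCycle (onlyAt y) bottomRightSquare)
  decide y = (y ≟ᶜ centre) ⊎-dec (isCycle? (onlyAt y) topLeftSquare ⊎-dec isCycle? (onlyAt y) bottomRightSquare)
    where open Decisions _≟ᵇ_ using (isCycle?)

centreAnd-acyclic : ∀ y → y ≢ centre → Acyclic (centreAnd y)
centreAnd-acyclic y y≢centre =
  [ ⊥-elim ∘ y≢centre , Decisions.Peelable⇒Acyclic _≟ᵇ_ (centreAnd y) ]′ (∀-cell decide _ y)
  where
  decide : ∀ y → Dec (y ≡ centre ⊎ Decisions.Peelable _≟ᵇ_ (centreAnd y))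
  decide y = (y ≟ᶜ centre) ⊎-dec Decisions.peelable? _≟ᵇ_ (centreAnd y)

transcript : {S : Set} → Coloring S → List Cell → List (Cell × S)
transcript f = map (λ q → q , f q)

queries-transcript : ∀ {S} (f : Coloring S) qs → map proj₁ (transcript f qs) ≡ qs
queries-transcript f qs = trans (sym (map-∘ qs)) (map-id qs)

Extends-transcript : ∀ {S} {c f : Coloring S} {qs} → (∀ {q} → q ∈ qs → c q ≡ f q) → Extends c (transcript f qs)
Extends-transcript agree = All-map⁺ (All.tabulate agree)

run-∷ʳ : ∀ {S} (A : Adversary S) h qs q → run A h (qs ∷ʳ q) ≡ run A h qs ∷ʳ (q , A (run A h qs) q)
run-∷ʳ A h [] q = refl
run-∷ʳ A h (q′ ∷ qs) q = run-∷ʳ A (h ++ [ q′ , A h q′ ]) qs q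

BothOpen : {S : Set} → List (Cell × S) → Set
BothOpen {S} h = (∃[ c ] (Extends {S} c h × HasCycle c)) × (∃[ c ] (Extends {S} c h × Acyclic c))

module Strategy {S : Set} (paint : Bool → S) (paint-injective : Injective _≡_ _≡_ paint) where

  Trigger : List Cell → Set
  Trigger ps = length ps ≡ 7 × centre ∉ ps

  trigger? : ∀ ps → Dec (Trigger ps)
  trigger? ps = (length ps ≟ⁿ 7) ×-dec ¬? (centre ∈ᶜ? ps)

  answer : List Cell → Cell → Bool
  answer ps q = does (trigger? ps) ∨ onlyAt centre q

  strategy : Adversary S
  strategy h q = paint (answer (map proj₁ h) q)

  default : Coloring S
  default = paint ∘ onlyAt centre

  answer-untriggered : ∀ {ps} q → ¬ Trigger ps → answer ps q ≡ onlyAt centre q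
  answer-untriggered {ps} q untriggered = cong (_∨ onlyAt centre q) (dec-false (trigger? ps) untriggered)

  answer-triggered : ∀ {ps} q → Trigger ps → answer ps q ≡ true
  answer-triggered {ps} q triggered = cong (_∨ onlyAt centre q) (dec-true (trigger? ps) triggered)

  answer-once-centre-queried : ∀ {ps q} → centre ∈ ps ∷ʳ q → answer ps q ≡ onlyAt centre q
  answer-once-centre-queried {ps} {q} centre∈ with ∈-++⁻ ps centre∈
  ... | inj₁ centre∈ps = answer-untriggered q (λ (_ , centre∉ps) → centre∉ps centre∈ps)
  ... | inj₂ (here refl) = ∨-zeroʳ _

  run-∷ʳ-strategy : ∀ {ps} q → run strategy [] ps ≡ transcript default ps →
                    run strategy [] (ps ∷ʳ q) ≡ transcript default ps ∷ʳ (q , paint (answer ps q))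
  run-∷ʳ-strategy {ps} q honest = begin
    run strategy [] (ps ∷ʳ q)
      ≡⟨ run-∷ʳ strategy [] ps q ⟩
    run strategy [] ps ∷ʳ (q , strategy (run strategy [] ps) q)
      ≡⟨ cong (λ h → h ∷ʳ (q , strategy h q)) honest ⟩
    transcript default ps ∷ʳ (q , paint (answer (map proj₁ (transcript default ps)) q))
      ≡⟨ cong (λ qs → transcript default ps ∷ʳ (q , paint (answer qs q))) (queries-transcript default ps) ⟩
    transcript default ps ∷ʳ (q , paint (answer ps q))
      ∎
    where open ≡-Reasoning

  run-honest-step : ∀ {ps} q → run strategy [] ps ≡ transcript default ps → answer ps q ≡ onlyAt centre q →
                    run strategy [] (ps ∷ʳ q) ≡ transcript default (ps ∷ʳ q)
  run-honest-step {ps} q honest honest-answer = begin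
    run strategy [] (ps ∷ʳ q)                          ≡⟨ run-∷ʳ-strategy q honest ⟩
    transcript default ps ∷ʳ (q , paint (answer ps q)) ≡⟨ cong (λ b → transcript default ps ∷ʳ (q , paint b)) honest-answer ⟩
    transcript default ps ∷ʳ (q , default q)           ≡⟨ sym (map-++ _ ps [ q ]) ⟩
    transcript default (ps ∷ʳ q)                       ∎
    where open ≡-Reasoning

  run-trapped : ∀ {ps} q → run strategy [] ps ≡ transcript default ps → Trigger ps →
                run strategy [] (ps ∷ʳ q) ≡ transcript default ps ∷ʳ (q , paint true)
  run-trapped {ps} q honest triggered = begin
    run strategy [] (ps ∷ʳ q)                          ≡⟨ run-∷ʳ-strategy q honest ⟩
    transcript default ps ∷ʳ (q , paint (answer ps q)) ≡⟨ cong (λ b → transcript default ps ∷ʳ (q , paint b))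
                                                               (answer-triggered q triggered) ⟩
    transcript default ps ∷ʳ (q , paint true)          ∎
    where open ≡-Reasoning

  run-short : ∀ qs → length qs ≤ 7 → run strategy [] qs ≡ transcript default qs
  run-short qs = go (reverseView qs)
    where
    go : ∀ {qs} → Reverse qs → length qs ≤ 7 → run strategy [] qs ≡ transcript default qs
    go [] _ = refl
    go (ps ∶ view ∶ʳ q) short =
      run-honest-step q (go view (≤-trans (n≤1+n _) ps<7)) (answer-untriggered {ps} q (λ (seven , _) → <⇒≢ ps<7 seven))
      where
      ps<7 : suc (length ps) ≤ 7
      ps<7 = subst (_≤ 7) (length-∷ʳ ps) short

  default-open : ∀ {qs y} → y ∉ qs → y ≢ centre → BothOpen (transcript default qs)
  default-open {qs} {y} y∉qs y≢centre =
    (default , Extends-transcript (λ _ → refl) , HasCycle-∘ paint onlyAt-centre-cyclic) ,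
    (paint ∘ centreAnd y , Extends-transcript (λ q∈qs → cong paint (centreAnd-≢ (∈-∉⇒≢ q∈qs y∉qs))) ,
      Acyclic-∘ paint paint-injective (centreAnd-acyclic y y≢centre))

  trapped-open : ∀ {ps q} → q ∉ ps → centre ∉ ps → q ≢ centre →
                 BothOpen (transcript default ps ∷ʳ (q , paint true))
  trapped-open {ps} {q} q∉ps centre∉ps q≢centre =
    (paint ∘ onlyAt q , extends unmarked (onlyAt-self q) , HasCycle-∘ paint (onlyAt-cyclic q q≢centre)) ,
    (paint ∘ centreAnd q , extends (λ p∈ps → centreAnd-≢ (∈-∉⇒≢ p∈ps q∉ps)) (centreAnd-self q) ,
      Acyclic-∘ paint paint-injective (centreAnd-acyclic q q≢centre))
    where
    unmarked : ∀ {p} → p ∈ ps → onlyAt q p ≡ onlyAt centre p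
    unmarked p∈ps = trans (onlyAt-≢ (∈-∉⇒≢ p∈ps q∉ps)) (sym (onlyAt-≢ (∈-∉⇒≢ p∈ps centre∉ps)))
    extends : ∀ {b : Coloring Bool} → (∀ {p} → p ∈ ps → b p ≡ onlyAt centre p) → b q ≡ true →
              Extends (paint ∘ b) (transcript default ps ∷ʳ (q , paint true))
    extends agree marked = All-++⁺ (Extends-transcript (cong paint ∘ agree)) (cong paint marked ∷ [])

  short-run-open : ∀ qs → length qs ≤ 7 → BothOpen (run strategy [] qs)
  short-run-open qs ≤7 with missing-cell (centre ∷ qs) (s≤s ≤7)
  ... | y , y∉ = subst BothOpen (sym (run-short qs ≤7)) (default-open (y∉ ∘ there) (y∉ ∘ here))

  full-run-open : ∀ ps q → Unique (ps ∷ʳ q) → length (ps ∷ʳ q) ≡ 8 → BothOpen (run strategy [] (ps ∷ʳ q))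
  full-run-open ps q unique eight = by-centre (centre ∈ᶜ? (ps ∷ʳ q))
    where
    seven : length ps ≡ 7
    seven = suc-injective (trans (sym (length-∷ʳ ps)) eight)
    honest : run strategy [] ps ≡ transcript default ps
    honest = run-short ps (≤-reflexive seven)
    by-centre : Dec (centre ∈ ps ∷ʳ q) → BothOpen (run strategy [] (ps ∷ʳ q))
    by-centre (yes centre∈) with missing-cell (ps ∷ʳ q) (≤-reflexive eight)
    ... | y , y∉ = subst BothOpen (sym (run-honest-step q honest (answer-once-centre-queried centre∈)))
                     (default-open y∉ (≢-sym (∈-∉⇒≢ centre∈ y∉)))
    by-centre (no centre∉) =
      subst BothOpen (sym (run-trapped q honest (seven , centre∉ ∘ ∈-++⁺ˡ)))
        (trapped-open (unique-∷ʳ⇒∉ ps unique) (centre∉ ∘ ∈-++⁺ˡ) (λ q≡centre → centre∉ (∈-++⁺ʳ ps (here (sym q≡centre)))))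

  both-open : ∀ qs → Unique qs → length qs ≤ 8 → BothOpen (run strategy [] qs)
  both-open qs unique ≤8 with length qs ≤? 7 | initLast qs
  ... | yes ≤7 | _ = short-run-open qs ≤7
  ... | no ≰7 | [] = contradiction z≤n ≰7
  ... | no ≰7 | ps ∷ʳ′ q = full-run-open ps q unique (≤-antisym ≤8 (≰⇒> ≰7))

bit : ∀ {k} → Bool → Fin (suc (suc k))
bit false = zero
bit true = suc zero

bit-injective : ∀ {k} → Injective _≡_ _≡_ (bit {k})
bit-injective {x = false} {false} _ = refl
bit-injective {x = true} {true} _ = refl

lemma3 : (k : ℕ) → 2 ≤ k →
    ∃[ A ] ((qs : List Cell) → Unique qs → 1 ≤ length qs → length qs ≤ 8 →
      (∃[ c ] (Extends {Fin k} c (run A [] qs) × HasCycle c))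
      × (∃[ c ] (Extends {Fin k} c (run A [] qs) × Acyclic c)))
lemma3 (suc (suc k)) _ = strategy , λ qs unique _ ≤8 → both-open qs unique ≤8
  where open Strategy bit bit-injective
lemma3 (suc zero) (s≤s ())
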